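{- Let $G\parallel\mathcal M$ be a well-formed asynchronous type. (1) If $G\upharpoonright p=\bigoplus_{i\in I}q!\ell_i;P_i$, then for every $i\in I$ there is $G_i$ with $G\parallel\mathcal M\xrightarrow{pq!\ell_i}G_i\parallel\mathcal M\cdot(p,\ell_i,q)$ and $G_i\upharpoonright p=P_i$. (2) If $G\upharpoonright q=\sum_{i\in I}p?\ell_i;P_i$ and $\mathcal M\equiv(p,\ell,q)\cdot\mathcal M'$ for some $\ell$, then $I=\{k\}$, $\ell=\ell_k$, and $G\parallel\mathcal M\xrightarrow{pq?\ell_k}G'\parallel\mathcal M'$ for some $G'$ with $G'\upharpoonright q=P_k$.
   Context: Participants $p,q,r,s$; labels $\ell$. Processes: regular terms coinductively generated by $P::=\bigoplus_{i\in I}q!\ell_i;P_i\mid\sum_{i\in I}q?\ell_i;P_i\mid\mathbf 0$ ($I$ finite non-empty, pairwise distinct labels). Messages $(p,\ell,q)$; a queue $\mathcal M$ is a finite sequence of messages ($\emptyset$ empty, $\cdot$ concatenation) modulo the equivalence $\equiv$ allowing adjacent $(p,\ell,q),(r,\ell',s)$ to be swapped when $p\neq r$ or $q\neq s$. Global types: regular terms coinductively generated by $G::=\boxplus_{i\in I}pq!\ell_i;G_i\mid pq?\ell;G\mid\mathsf{End}$; asynchronous types $G\parallel\mathcal M$. Communications $\beta$: $pq!\ell$, $pq?\ell$, $\mathrm{play}(pq!\ell)=\{p\}$, $\mathrm{play}(pq?\ell)=\{q\}$; $\mathrm{play}(G)$ least set with $\mathrm{play}(\boxplus_i pq!\ell_i;G_i)=\{p\}\cup\bigcup_i\mathrm{play}(G_i)$,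 $\mathrm{play}(pq?\ell;G)=\{q\}\cup\mathrm{play}(G)$, $\mathrm{play}(\mathsf{End})=\emptyset$; $\mathrm{Tr}(G)$ sequences of communications along root-to-edge paths of $G$'s tree; cyclic = tree contains itself as proper subtree. Projection $G\upharpoonright r$ (partial, coinductive; $\vec\pi$ possibly empty action sequence): $\mathbf 0$ if $r\notin\mathrm{play}(G)$; $(\boxplus_{i\in I}pq!\ell_i;G_i)\upharpoonright r$ is $\bigoplus_i q!\ell_i;(G_i\upharpoonright p)$ if $r=p$; $G_1\upharpoonright q$ if $r=q$, $I=\{1\}$; $\vec\pi;\sum_i p?\ell_i;P_i$ if $r=q$, $|I|>1$, $G_i\upharpoonright q=\vec\pi;p?\ell_i;P_i$ for all $i$; $G_1\upharpoonright r$ if $r\notin\{p,q\}$, $r\in\mathrm{play}(G_1)$, $G_i\upharpoonright r=G_1\upharpoonright r$ for all $i$; $(pq?\ell;G)\upharpoonright r$ is $p?\ell;(G\upharpoonright r)$ if $r=q$, $G\upharpoonright r$ if $r\neq q$ and $r\in\mathrm{play}(G)$; undefined otherwise. Depth: $\mathrm{ord}(\tau,p)=n$ if $\tau=\tau_1\cdot\beta\cdot\tau_2$, $|\tau_1|=n-1$, $p\notin\mathrm{play}(\tau_1)$, $p\in\mathrm{play}(\beta)$, else $0$; $\mathrm{depth}(G,p)=\sup_{\tau\in\mathrm{Tr}(G)}\mathrm{ord}(\tau,p)$ if $p\in\mathrm{play}(G)$, else $0$; bounded if finite for all subtrees and participants. Balancing: $\vdash G\parallel\mathcal M$ if derivable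 by a possibly infinite derivation from: $\vdash\mathsf{End}\parallel\emptyset$; $\vdash G\parallel\mathcal M\Rightarrow\vdash pq?\ell;G\parallel(p,\ell,q)\cdot\mathcal M$; $\vdash G_i\parallel\mathcal M\cdot(p,\ell_i,q)\ \forall i\in I\Rightarrow\vdash\boxplus_{i\in I}pq!\ell_i;G_i\parallel\mathcal M$, provided $\mathcal M=\emptyset$ if that type is cyclic. Well formed: balanced, all projections defined, bounded. LTS of asynchronous types (inductive): (Ext-Out) $\boxplus_{i\in I}pq!\ell_i;G_i\parallel\mathcal M\xrightarrow{pq!\ell_k}G_k\parallel\mathcal M\cdot(p,\ell_k,q)$, $k\in I$; (Ext-In) $pq?\ell;G\parallel(p,\ell,q)\cdot\mathcal M\xrightarrow{pq?\ell}G\parallel\mathcal M$; (IComm-Out) if $G_i\parallel\mathcal M\cdot(p,\ell_i,q)\xrightarrow{\beta}G'_i\parallel\mathcal M'\cdot(p,\ell_i,q)$ for all $i$ and $p\notin\mathrm{play}(\beta)$ then $\boxplus_i pq!\ell_i;G_i\parallel\mathcal M\xrightarrow{\beta}\boxplus_i pq!\ell_i;G'_i\parallel\mathcal M'$; (IComm-In) if $G\parallel\mathcal M\xrightarrow{\beta}G'\parallel\mathcal M'$ and $q\notin\mathrm{play}(\beta)$ then $pq?\ell;G\parallel(p,\ell,q)\cdot\mathcal M\xrightarrow{\beta}pq?\ell;G'\parallel(p,\ell,q)\cdot\mathcal M'$. -}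

module Defs where

-- Infinite (coinductively generated) trees are represented WITHOUT coinduction: a tree is a function assigning a node to
-- every path, a path being the list of labels chosen from the root.  Only the
-- paths that are valid in the tree are meaningful.  Coinductive predicates
-- (projection, balancing) are greatest fixpoints, encoded as "there is a
-- post-fixpoint relation containing the triple" (Knaster-Tarski).

open import Level using (Level) renaming (suc to lsuc; zero to lzero)
open import Data.Nat using (ℕ; zero; suc; _≤_; _<_)
open import Data.Nat.Properties using (_≟_)
open import Data.List using (List; []; _∷_; _++_; _∷ʳ_; length)
open import Data.List.Membership.Propositional using (_∈_)
open import Data.List.Relation.Unary.Any using (Any)
open import Data.List.Relation.Unary.Unique.Propositional using (Unique)
open import Data.List.Relation.Binary.Permutation.Propositional using (_↭_)
open import Data.Product using (Σ; ∃; _×_; _,_)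
open import Data.Sum using (_⊎_)
open import Data.Unit using (⊤)
open import Data.Empty using (⊥)
open import Relation.Nullary using (¬_; yes; no)
open import Relation.Binary.PropositionalEquality using (_≡_; _≢_; refl)

Part : Set
Part = ℕ

Label : Set
Label = ℕ

Path : Set
Path = List Label

-- Global types  G ::= ⊞_{i∈I} pq!ℓ_i;G_i | pq?ℓ;G | End
-- A node  gout p q ls  lists the labels ℓ_i (i ∈ I); the continuation G_i
-- is the subtree reached by the label ℓ_i.

data GNode : Set where
  gout : Part → Part → List Label → GNode
  gin  : Part → Part → Label → GNode
  gend : GNode

GT : Set
GT = Path → GNode

_/_ : GT → Label → GT
(G / ℓ) π = G (ℓ ∷ π)

at : GT → Path → GT
at G π σ = G (π ++ σ)

gchildren : GNode → List Label
gchildren (gout _ _ ls) = ls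
gchildren (gin _ _ ℓ) = ℓ ∷ []
gchildren gend = []

data ValidG (G : GT) : Path → Set where
  v-root : ValidG G []
  v-step : ∀ {ℓ π} → ℓ ∈ gchildren (G []) → ValidG (G / ℓ) π → ValidG G (ℓ ∷ π)

GNodeOK : GNode → Set
GNodeOK (gout _ _ ls) = (ls ≢ []) × Unique ls
GNodeOK (gin _ _ _) = ⊤
GNodeOK gend = ⊤

IsGT : GT → Set
IsGT G = ∀ π → ValidG G π → GNodeOK (G π)

-- equality of nodes (the label set I is unordered)
data _≈N_ : GNode → GNode → Set where
  ≈out : ∀ {p q ls ls'} → ls ↭ ls' → gout p q ls ≈N gout p q ls'
  ≈in  : ∀ {p q ℓ} → gin p q ℓ ≈N gin p q ℓ
  ≈end : gend ≈N gend

_≅G_ : GT → GT → Set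
G ≅G H = ∀ π → ValidG G π → G π ≈N H π

Cyclic : GT → Set
Cyclic G = Σ Path λ π → (π ≢ []) × ValidG G π × (at G π ≅G G)

Regular : GT → Set
Regular G = Σ (List GT) λ Ls → ∀ π → ValidG G π → Any (λ H → at G π ≅G H) Ls

data PNode : Set where
  out : Part → List Label → PNode
  inp : Part → List Label → PNode
  end : PNode

Proc : Set
Proc = Path → PNode

_/ₚ_ : Proc → Label → Proc
(P /ₚ ℓ) π = P (ℓ ∷ π)

data Act : Set where
  aout : Part → Label → Act
  ain  : Part → Label → Act

actLabel : Act → Label
actLabel (aout _ ℓ) = ℓ
actLabel (ain _ ℓ) = ℓ

actNode : Act → PNode
actNode (aout q ℓ) = out q (ℓ ∷ [])
actNode (ain p ℓ) = inp p (ℓ ∷ [])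

step : Act → Proc → Proc
step a P [] = actNode a
step a P (_ ∷ π) = P π

prefix : List Act → Proc → Proc
prefix [] P = P
prefix (a ∷ as) P = step a (prefix as P)

-- "P = π⃗ ; P'" for some P' satisfying K
HasPrefix : List Act → (Proc → Set) → Proc → Set
HasPrefix [] K P = K P
HasPrefix (a ∷ as) K P = (P [] ≡ actNode a) × HasPrefix as K (P /ₚ actLabel a)

data InPlay (r : Part) (G : GT) : Set where
  pl-out     : ∀ {p q ls} → G [] ≡ gout p q ls → r ≡ p → InPlay r G
  pl-out-sub : ∀ {p q ls ℓ} → G [] ≡ gout p q ls → ℓ ∈ ls → InPlay r (G / ℓ) → InPlay r G
  pl-in      : ∀ {p q ℓ} → G [] ≡ gin p q ℓ → r ≡ q → InPlay r G
  pl-in-sub  : ∀ {p q ℓ} → G [] ≡ gin p q ℓ → InPlay r (G / ℓ) → InPlay r G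

-- Projection G ↾ r = P : one unfolding step, relative to a relation R
-- for the coinductive calls (clauses in the order of the paper; later
-- clauses apply only when r ∈ play(G)).

data ProjF (R : GT → Part → Proc → Set) (G : GT) (r : Part) (P : Proc) : Set where
  pj-zero     : ¬ InPlay r G → P [] ≡ end → ProjF R G r P
  pj-send     : ∀ {p q ls ls'} → G [] ≡ gout p q ls → r ≡ p
              → P [] ≡ out q ls' → ls ↭ ls'
              → (∀ ℓ → ℓ ∈ ls → R (G / ℓ) p (P /ₚ ℓ)) → ProjF R G r P
  pj-recv1    : ∀ {p q ℓ} → G [] ≡ gout p q (ℓ ∷ []) → r ≡ q → r ≢ p → InPlay r G
              → R (G / ℓ) q P → ProjF R G r P
  -- r = q, |I| > 1 :  π⃗ ; Σ_i p?ℓ_i ; P_i   where  G_i ↾ q = π⃗ ; p?ℓ_i ; P_i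
  pj-recvN    : ∀ {p q ls} → G [] ≡ gout p q ls → r ≡ q → r ≢ p → InPlay r G
              → 1 < length ls → (π : List Act)
              → HasPrefix π (λ P' → Σ (List Label) λ ls' → (P' [] ≡ inp p ls') × (ls ↭ ls')
                   × (∀ ℓ → ℓ ∈ ls → R (G / ℓ) q (prefix π (step (ain p ℓ) (P' /ₚ ℓ))))) P
              → ProjF R G r P
  pj-other    : ∀ {p q ℓ₁ ls₀} → G [] ≡ gout p q (ℓ₁ ∷ ls₀) → r ≢ p → r ≢ q
              → InPlay r (G / ℓ₁) → (∀ ℓ → ℓ ∈ ℓ₁ ∷ ls₀ → R (G / ℓ) r P) → ProjF R G r P
  pj-in-rcv   : ∀ {p q ℓ} → G [] ≡ gin p q ℓ → r ≡ q
              → P [] ≡ inp p (ℓ ∷ []) → R (G / ℓ) r (P /ₚ ℓ) → ProjF R G r P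
  pj-in-other : ∀ {p q ℓ} → G [] ≡ gin p q ℓ → r ≢ q → InPlay r (G / ℓ)
              → R (G / ℓ) r P → ProjF R G r P

Proj : GT → Part → Proc → Set₁
Proj G r P = Σ (GT → Part → Proc → Set) λ R →
               (∀ G' r' P' → R G' r' P' → ProjF R G' r' P') × R G r P

data Comm : Set where
  snd : Part → Part → Label → Comm
  rcv : Part → Part → Label → Comm

playC : Comm → Part
playC (snd p q ℓ) = p
playC (rcv p q ℓ) = q

record Msg : Set where
  constructor msg
  field
    from  : Part
    label : Label
    to    : Part

Queue : Set
Queue = List Msg

Indep : Msg → Msg → Set
Indep (msg p _ q) (msg r _ s) = (p ≢ r) ⊎ (q ≢ s)

data _≈Q_ : Queue → Queue → Set where
  ≈refl  : ∀ {M} → M ≈Q M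
  ≈sym   : ∀ {M M'} → M ≈Q M' → M' ≈Q M
  ≈trans : ∀ {M M' M''} → M ≈Q M' → M' ≈Q M'' → M ≈Q M''
  ≈swap  : ∀ M₁ M₂ m m' → Indep m m' → (M₁ ++ m ∷ m' ∷ M₂) ≈Q (M₁ ++ m' ∷ m ∷ M₂)

data Trace (G : GT) : List Comm → Set where
  tr-nil : Trace G []
  tr-out : ∀ {p q ls ℓ τ} → G [] ≡ gout p q ls → ℓ ∈ ls
         → Trace (G / ℓ) τ → Trace G (snd p q ℓ ∷ τ)
  tr-in  : ∀ {p q ℓ τ} → G [] ≡ gin p q ℓ
         → Trace (G / ℓ) τ → Trace G (rcv p q ℓ ∷ τ)

-- ord(τ,p): 1-based position of the first communication played by p, else 0
ord : List Comm → Part → ℕ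
ord [] p = 0
ord (β ∷ τ) p with playC β ≟ p
... | yes _ = 1
... | no _ with ord τ p
...   | zero = 0
...   | suc k = suc (suc k)

-- depth(H,p) finite for every subtree H of G and every participant p
-- (depth(H,p) = 0 when p ∉ play(H))
Bounded : GT → Set
Bounded G = ∀ π → ValidG G π → ∀ p → InPlay p (at G π) →
            Σ ℕ λ N → ∀ τ → Trace (at G π) τ → ord τ p ≤ N

data BalF (R : GT → Queue → Set) (G : GT) (M : Queue) : Set where
  bal-end : G [] ≡ gend → M ≈Q [] → BalF R G M
  bal-in  : ∀ {p q ℓ M₀} → G [] ≡ gin p q ℓ → M ≈Q (msg p ℓ q ∷ M₀)
          → R (G / ℓ) M₀ → BalF R G M
  bal-out : ∀ {p q ls} → G [] ≡ gout p q ls → (Cyclic G → M ≈Q [])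
          → (∀ ℓ → ℓ ∈ ls → R (G / ℓ) (M ∷ʳ msg p ℓ q)) → BalF R G M

Balanced : GT → Queue → Set₁
Balanced G M = Σ (GT → Queue → Set) λ R →
                 (∀ G' M' → R G' M' → BalF R G' M') × R G M

WellFormed : GT → Queue → Set₁
WellFormed G M = Balanced G M × (∀ r → Σ Proc λ P → Proj G r P) × Bounded G

data Step : GT → Queue → Comm → GT → Queue → Set where
  ext-out   : ∀ {G G' M M' p q ls ℓ} → G [] ≡ gout p q ls → ℓ ∈ ls
            → G' ≅G (G / ℓ) → M' ≈Q (M ∷ʳ msg p ℓ q)
            → Step G M (snd p q ℓ) G' M'
  ext-in    : ∀ {G G' M M₀ M' p q ℓ} → G [] ≡ gin p q ℓ
            → M ≈Q (msg p ℓ q ∷ M₀) → G' ≅G (G / ℓ) → M' ≈Q M₀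
            → Step G M (rcv p q ℓ) G' M'
  icomm-out : ∀ {G G' M M' p q ls β} → G [] ≡ gout p q ls → G' [] ≡ gout p q ls
            → p ≢ playC β
            → (∀ ℓ → ℓ ∈ ls → Step (G / ℓ) (M ∷ʳ msg p ℓ q) β (G' / ℓ) (M' ∷ʳ msg p ℓ q))
            → Step G M β G' M'
  icomm-in  : ∀ {G G' M M' M₀ M₀' p q ℓ β} → G [] ≡ gin p q ℓ → G' [] ≡ gin p q ℓ
            → M ≈Q (msg p ℓ q ∷ M₀) → M' ≈Q (msg p ℓ q ∷ M₀')
            → q ≢ playC β
            → Step (G / ℓ) M₀ β (G' / ℓ) M₀'
            → Step G M β G' M'

-- Both parts go by induction on a bound N for depth(G, r), where r is the participant whose
-- projection performs the action: p for the send, q for the receive.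
-- If r plays the first communication of G, the step is external; for a receive, balancing puts
-- a message of channel pq in front of the queue, and as ≈Q never reorders a channel it is
-- (p, ℓ, q). Otherwise r does not play it, so its depth drops in every continuation: the
-- induction hypothesis gives the step there, IComm-Out / IComm-In reassemble the results under
-- the leading communication, and the reassembled type projects on r by the same projection
-- clause, witnessed by the union of the continuations' post-fixpoints.

module Submission where

open import Defs
open import Data.Empty using (⊥; ⊥-elim)
open import Data.List using (List; []; _∷_; _∷ʳ_; _++_; length)
open import Data.List.Properties using (++-assoc; ∷-injectiveˡ)
open import Data.List.Membership.Propositional using (_∈_)
open import Data.Nat using (ℕ; zero; suc; _≤_; _<_; z≤n; s≤s)
open import Data.Nat.Properties using (_≟_; ≤-trans; n≮0)
open import Data.List.Membership.DecPropositional _≟_ using (_∈?_)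
open import Data.List.Relation.Unary.All using () renaming (_∷_ to _∷ᵃ_)
open import Data.List.Relation.Unary.AllPairs using () renaming (_∷_ to _∷ᵖ_)
open import Data.List.Relation.Unary.Any using (here; there)
open import Data.List.Relation.Unary.Unique.Propositional using (Unique)
open import Data.List.Relation.Binary.Permutation.Propositional using (_↭_; ↭-refl; ↭-sym)
open import Data.List.Relation.Binary.Permutation.Propositional.Properties using (∈-resp-↭)
open import Data.Maybe using (Maybe; just; nothing)
open import Data.Maybe.Properties using (just-injective)
open import Data.Product using (Σ; _×_; _,_; proj₁; proj₂; map₂)
open import Data.Sum using (_⊎_; inj₁; inj₂)
open import Data.Unit using (⊤; tt)
open import Relation.Nullary using (¬_; Dec; yes; no)
open import Relation.Nullary.Decidable using (_×-dec_)
open import Relation.Binary.PropositionalEquality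
  using (_≡_; _≢_; refl; sym; trans; subst; subst₂; ≢-sym)

≈Q-∷ : ∀ {M₁ M₂} m → M₁ ≈Q M₂ → (m ∷ M₁) ≈Q (m ∷ M₂)
≈Q-∷ m ≈refl = ≈refl
≈Q-∷ m (≈sym e) = ≈sym (≈Q-∷ m e)
≈Q-∷ m (≈trans e f) = ≈trans (≈Q-∷ m e) (≈Q-∷ m f)
≈Q-∷ m (≈swap M₁ M₂ n n' i) = ≈swap (m ∷ M₁) M₂ n n' i

≈Q-∷ʳ : ∀ {M₁ M₂} m → M₁ ≈Q M₂ → (M₁ ∷ʳ m) ≈Q (M₂ ∷ʳ m)
≈Q-∷ʳ m ≈refl = ≈refl
≈Q-∷ʳ m (≈sym e) = ≈sym (≈Q-∷ʳ m e)
≈Q-∷ʳ m (≈trans e f) = ≈trans (≈Q-∷ʳ m e) (≈Q-∷ʳ m f)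
≈Q-∷ʳ m (≈swap M₁ M₂ n n' i) =
  subst₂ _≈Q_ (sym (++-assoc M₁ (n ∷ n' ∷ M₂) (m ∷ []))) (sym (++-assoc M₁ (n' ∷ n ∷ M₂) (m ∷ [])))
    (≈swap M₁ (M₂ ∷ʳ m) n n' i)

≈Q-swapLast : ∀ M {m m'} → Indep m m' → ((M ∷ʳ m) ∷ʳ m') ≈Q ((M ∷ʳ m') ∷ʳ m)
≈Q-swapLast M {m} {m'} i =
  subst₂ _≈Q_ (sym (++-assoc M (m ∷ []) (m' ∷ []))) (sym (++-assoc M (m' ∷ []) (m ∷ [])))
    (≈swap M [] m m' i)

OnChannel : Part → Part → Msg → Set
OnChannel p q m = (Msg.from m ≡ p) × (Msg.to m ≡ q)

onChannel? : ∀ p q m → Dec (OnChannel p q m)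
onChannel? p q m = (Msg.from m ≟ p) ×-dec (Msg.to m ≟ q)

-- Swaps never reorder two messages of one channel, so the oldest message of a
-- channel, and the queue without it, are invariants of ≈Q.
headOn : Part → Part → Queue → Maybe Label
headOn p q [] = nothing
headOn p q (m ∷ M) with onChannel? p q m
... | yes _ = just (Msg.label m)
... | no _ = headOn p q M

removeOn : Part → Part → Queue → Queue
removeOn p q [] = []
removeOn p q (m ∷ M) with onChannel? p q m
... | yes _ = M
... | no _ = m ∷ removeOn p q M

headOn-on : ∀ p q {m} M → OnChannel p q m → headOn p q (m ∷ M) ≡ just (Msg.label m)
headOn-on p q {m} M on with onChannel? p q m
... | yes _ = refl
... | no off = ⊥-elim (off on)

removeOn-on : ∀ p q {m} M → OnChannel p q m → removeOn p q (m ∷ M) ≡ M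
removeOn-on p q {m} M on with onChannel? p q m
... | yes _ = refl
... | no off = ⊥-elim (off on)

headOn-off : ∀ p q {m} M → ¬ OnChannel p q m → headOn p q (m ∷ M) ≡ headOn p q M
headOn-off p q {m} M off with onChannel? p q m
... | yes on = ⊥-elim (off on)
... | no _ = refl

removeOn-off : ∀ p q {m} M → ¬ OnChannel p q m → removeOn p q (m ∷ M) ≡ m ∷ removeOn p q M
removeOn-off p q {m} M off with onChannel? p q m
... | yes on = ⊥-elim (off on)
... | no _ = refl

Indep⇒¬bothOnChannel : ∀ {p q m m'} → Indep m m' → OnChannel p q m → ¬ OnChannel p q m'
Indep⇒¬bothOnChannel (inj₁ from≢) (refl , _) (from≡ , _) = from≢ (sym from≡)
Indep⇒¬bothOnChannel (inj₂ to≢) (_ , refl) (_ , to≡) = to≢ (sym to≡)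

¬OnChannel⇒Indep : ∀ {p q} m ℓ → ¬ OnChannel p q m → Indep m (msg p ℓ q)
¬OnChannel⇒Indep {p} m ℓ off with Msg.from m ≟ p
... | no from≢ = inj₁ from≢
... | yes from≡ = inj₂ (λ to≡ → off (from≡ , to≡))

headOn-swap : ∀ p q M₁ M₂ m m' → Indep m m' →
              headOn p q (M₁ ++ m ∷ m' ∷ M₂) ≡ headOn p q (M₁ ++ m' ∷ m ∷ M₂)
headOn-swap p q (n ∷ M₁) M₂ m m' i with onChannel? p q n
... | yes _ = refl
... | no _ = headOn-swap p q M₁ M₂ m m' i
headOn-swap p q [] M₂ m m' i with onChannel? p q m | onChannel? p q m'
... | yes on | yes on' = ⊥-elim (Indep⇒¬bothOnChannel {p} {q} {m} {m'} i on on')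
... | yes on | no _ = sym (headOn-on p q M₂ on)
... | no _ | yes on' = headOn-on p q M₂ on'
... | no off | no off' = trans (headOn-off p q M₂ off') (sym (headOn-off p q M₂ off))

removeOn-swap : ∀ p q M₁ M₂ m m' → Indep m m' →
                removeOn p q (M₁ ++ m ∷ m' ∷ M₂) ≈Q removeOn p q (M₁ ++ m' ∷ m ∷ M₂)
removeOn-swap p q (n ∷ M₁) M₂ m m' i with onChannel? p q n
... | yes _ = ≈swap M₁ M₂ m m' i
... | no _ = ≈Q-∷ n (removeOn-swap p q M₁ M₂ m m' i)
removeOn-swap p q [] M₂ m m' i with onChannel? p q m | onChannel? p q m'
... | yes on | yes on' = ⊥-elim (Indep⇒¬bothOnChannel {p} {q} {m} {m'} i on on')
... | yes on | no _ = subst (λ M → (m' ∷ M₂) ≈Q (m' ∷ M)) (sym (removeOn-on p q M₂ on)) ≈refl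
... | no _ | yes on' = subst (λ M → (m ∷ M) ≈Q (m ∷ M₂)) (sym (removeOn-on p q M₂ on')) ≈refl
... | no off | no off' =
  subst₂ (λ M M' → (m ∷ M) ≈Q (m' ∷ M')) (sym (removeOn-off p q M₂ off')) (sym (removeOn-off p q M₂ off))
    (≈swap [] (removeOn p q M₂) m m' i)

headOn-resp-≈Q : ∀ {p q M₁ M₂} → M₁ ≈Q M₂ → headOn p q M₁ ≡ headOn p q M₂
headOn-resp-≈Q ≈refl = refl
headOn-resp-≈Q (≈sym e) = sym (headOn-resp-≈Q e)
headOn-resp-≈Q (≈trans e f) = trans (headOn-resp-≈Q e) (headOn-resp-≈Q f)
headOn-resp-≈Q {p} {q} (≈swap M₁ M₂ m m' i) = headOn-swap p q M₁ M₂ m m' i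

removeOn-resp-≈Q : ∀ {p q M₁ M₂} → M₁ ≈Q M₂ → removeOn p q M₁ ≈Q removeOn p q M₂
removeOn-resp-≈Q ≈refl = ≈refl
removeOn-resp-≈Q (≈sym e) = ≈sym (removeOn-resp-≈Q e)
removeOn-resp-≈Q (≈trans e f) = ≈trans (removeOn-resp-≈Q e) (removeOn-resp-≈Q f)
removeOn-resp-≈Q {p} {q} (≈swap M₁ M₂ m m' i) = removeOn-swap p q M₁ M₂ m m' i

≈Q-bringToFront : ∀ p q ℓ M → headOn p q M ≡ just ℓ → M ≈Q (msg p ℓ q ∷ removeOn p q M)
≈Q-bringToFront p q ℓ [] ()
≈Q-bringToFront p q ℓ (m ∷ M) head≡ with onChannel? p q m
≈Q-bringToFront p q ℓ (msg .p ℓ' .q ∷ M) head≡ | yes (refl , refl) with just-injective head≡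
... | refl = ≈refl
≈Q-bringToFront p q ℓ (m ∷ M) head≡ | no off =
  ≈trans (≈Q-∷ m (≈Q-bringToFront p q ℓ M head≡))
         (≈swap [] (removeOn p q M) m (msg p ℓ q) (¬OnChannel⇒Indep m ℓ off))

≈Q-∷-sameChannel⁻¹ : ∀ {p q ℓ ℓ' M₁ M₂} → (msg p ℓ q ∷ M₁) ≈Q (msg p ℓ' q ∷ M₂) →
                     (ℓ ≡ ℓ') × (M₁ ≈Q M₂)
≈Q-∷-sameChannel⁻¹ {p} {q} {ℓ} {ℓ'} {M₁} {M₂} e =
  just-injective (trans (sym (headOn-on p q M₁ (refl , refl)))
                        (trans (headOn-resp-≈Q e) (headOn-on p q M₂ (refl , refl)))) ,
  subst₂ _≈Q_ (removeOn-on p q M₁ (refl , refl)) (removeOn-on p q M₂ (refl , refl)) (removeOn-resp-≈Q e)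

≈Q-∷-otherChannel⁻¹ : ∀ {p q ℓ m M₁ M₂} → ¬ OnChannel p q m → (m ∷ M₁) ≈Q (msg p ℓ q ∷ M₂) →
                      Σ Queue λ M → (M₁ ≈Q (msg p ℓ q ∷ M)) × (M₂ ≈Q (m ∷ M))
≈Q-∷-otherChannel⁻¹ {p} {q} {ℓ} {m} {M₁} {M₂} off e =
  removeOn p q M₁ ,
  ≈Q-bringToFront p q ℓ M₁
    (trans (sym (headOn-off p q M₁ off)) (trans (headOn-resp-≈Q e) (headOn-on p q M₂ (refl , refl)))) ,
  subst₂ _≈Q_ (removeOn-on p q M₂ (refl , refl)) (removeOn-off p q M₁ off) (removeOn-resp-≈Q (≈sym e))

Step-resp-≈Q : ∀ {G M β G' M₁ M₂} → Step G M β G' M₁ → M₁ ≈Q M₂ → Step G M β G' M₂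
Step-resp-≈Q (ext-out e ℓ∈ G'≅ M₁≈) M₁≈M₂ = ext-out e ℓ∈ G'≅ (≈trans (≈sym M₁≈M₂) M₁≈)
Step-resp-≈Q (ext-in e M≈ G'≅ M₁≈) M₁≈M₂ = ext-in e M≈ G'≅ (≈trans (≈sym M₁≈M₂) M₁≈)
Step-resp-≈Q (icomm-out e e' p≢ steps) M₁≈M₂ =
  icomm-out e e' p≢ (λ ℓ ℓ∈ → Step-resp-≈Q (steps ℓ ℓ∈) (≈Q-∷ʳ _ M₁≈M₂))
Step-resp-≈Q (icomm-in e e' M≈ M₁≈ q≢ s) M₁≈M₂ = icomm-in e e' M≈ (≈trans (≈sym M₁≈M₂) M₁≈) q≢ s

≈N-refl : ∀ n → n ≈N n
≈N-refl (gout p q ls) = ≈out ↭-refl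
≈N-refl (gin p q ℓ) = ≈in
≈N-refl gend = ≈end

≅G-refl : ∀ G → G ≅G G
≅G-refl G π _ = ≈N-refl (G π)

∈-gchildren : ∀ {m n ℓ} → m ≡ n → ℓ ∈ gchildren n → ℓ ∈ gchildren m
∈-gchildren {ℓ = ℓ} e = subst (λ n → ℓ ∈ gchildren n) (sym e)

IsGT-/ : ∀ {X n ℓ} → IsGT X → X [] ≡ n → ℓ ∈ gchildren n → IsGT (X / ℓ)
IsGT-/ {ℓ = ℓ} isGT e ℓ∈ π v = isGT (ℓ ∷ π) (v-step (∈-gchildren e ℓ∈) v)

IsGT-outLabels : ∀ {X a b ls} → IsGT X → X [] ≡ gout a b ls → (ls ≢ []) × Unique ls
IsGT-outLabels isGT e = subst GNodeOK e (isGT [] v-root)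

Unique⇒¬allEqual : ∀ {A : Set} {xs : List A} {y : A} → Unique xs → 1 < length xs → ¬ (∀ x → x ∈ xs → x ≡ y)
Unique⇒¬allEqual {xs = []} _ () _
Unique⇒¬allEqual {xs = _ ∷ []} _ (s≤s ()) _
Unique⇒¬allEqual {xs = x ∷ x' ∷ _} ((x≢x' ∷ᵃ _) ∷ᵖ _) _ all≡ =
  x≢x' (trans (all≡ x (here refl)) (sym (all≡ x' (there (here refl)))))

gout≢gin : ∀ {a b ls c d ℓ} → gout a b ls ≢ gin c d ℓ
gout≢gin ()

out≢inp : ∀ {a b c d} → out a b ≢ inp c d
out≢inp ()

out≢end : ∀ {q ls} → out q ls ≢ end
out≢end ()

inp≢end : ∀ {p ls} → inp p ls ≢ end
inp≢end ()

≡out⇒≢end : ∀ {n q ls} → n ≡ out q ls → n ≢ end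
≡out⇒≢end n≡out n≡end = out≢end (trans (sym n≡out) n≡end)

≡inp⇒≢end : ∀ {n p ls} → n ≡ inp p ls → n ≢ end
≡inp⇒≢end n≡inp n≡end = inp≢end (trans (sym n≡inp) n≡end)

end? : (n : PNode) → Dec (n ≡ end)
end? (out _ _) = no λ ()
end? (inp _ _) = no λ ()
end? end = yes refl

InPlay-out⁻¹ : ∀ {X a b ls r} → X [] ≡ gout a b ls → r ≢ a → InPlay r X →
               Σ Label λ ℓ → (ℓ ∈ ls) × InPlay r (X / ℓ)
InPlay-out⁻¹ e r≢a (pl-out e' r≡a) with trans (sym e) e'
... | refl = ⊥-elim (r≢a r≡a)
InPlay-out⁻¹ e r≢a (pl-out-sub e' ℓ∈ ip) with trans (sym e) e'
... | refl = _ , ℓ∈ , ip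
InPlay-out⁻¹ e r≢a (pl-in e' _) = ⊥-elim (gout≢gin (trans (sym e) e'))
InPlay-out⁻¹ e r≢a (pl-in-sub e' _) = ⊥-elim (gout≢gin (trans (sym e) e'))

InPlay-in⁻¹ : ∀ {X a b ℓ r} → X [] ≡ gin a b ℓ → r ≢ b → InPlay r X → InPlay r (X / ℓ)
InPlay-in⁻¹ e r≢b (pl-out e' _) = ⊥-elim (gout≢gin (trans (sym e') e))
InPlay-in⁻¹ e r≢b (pl-out-sub e' _ _) = ⊥-elim (gout≢gin (trans (sym e') e))
InPlay-in⁻¹ e r≢b (pl-in e' r≡b) with trans (sym e) e'
... | refl = ⊥-elim (r≢b r≡b)
InPlay-in⁻¹ e r≢b (pl-in-sub e' ip) with trans (sym e) e'
... | refl = ip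

Depth≤ : Part → GT → ℕ → Set
Depth≤ r X N = ∀ τ → Trace X τ → ord τ r ≤ N

ord-∷-played : ∀ β τ {r} → playC β ≡ r → 1 ≤ ord (β ∷ τ) r
ord-∷-played β τ {r} played with playC β ≟ r
... | yes _ = s≤s z≤n
... | no unplayed = ⊥-elim (unplayed played)

ord-∷-pos : ∀ β τ r → 1 ≤ ord τ r → 1 ≤ ord (β ∷ τ) r
ord-∷-pos β τ r pos with playC β ≟ r
... | yes _ = s≤s z≤n
... | no _ with ord τ r
...   | suc _ = s≤s z≤n

ord-∷-unplayed : ∀ β τ r N → playC β ≢ r → ord (β ∷ τ) r ≤ suc N → ord τ r ≤ N
ord-∷-unplayed β τ r N unplayed ord≤ with playC β ≟ r
... | yes played = ⊥-elim (unplayed played)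
... | no _ with ord τ r
...   | zero = z≤n
...   | suc _ with ord≤
...     | s≤s ord≤' = ord≤'

Depth≤-out : ∀ {X a b ls ℓ r N} → X [] ≡ gout a b ls → ℓ ∈ ls → r ≢ a →
             Depth≤ r X (suc N) → Depth≤ r (X / ℓ) N
Depth≤-out {a = a} {b} {ℓ = ℓ} {r} {N} e ℓ∈ r≢a depth τ t =
  ord-∷-unplayed (snd a b ℓ) τ r N (≢-sym r≢a) (depth _ (tr-out e ℓ∈ t))

Depth≤-in : ∀ {X a b ℓ r N} → X [] ≡ gin a b ℓ → r ≢ b → Depth≤ r X (suc N) → Depth≤ r (X / ℓ) N
Depth≤-in {a = a} {b} {ℓ} {r} {N} e r≢b depth τ t =
  ord-∷-unplayed (rcv a b ℓ) τ r N (≢-sym r≢b) (depth _ (tr-in e t))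

InPlay⇒trace : ∀ {X r} → IsGT X → InPlay r X → Σ (List Comm) λ τ → Trace X τ × 1 ≤ ord τ r
InPlay⇒trace isGT (pl-out {ls = []} e _) = ⊥-elim (proj₁ (IsGT-outLabels isGT e) refl)
InPlay⇒trace isGT (pl-out {p} {q} {ℓ ∷ _} e played) =
  _ , tr-out e (here refl) tr-nil , ord-∷-played (snd p q ℓ) [] (sym played)
InPlay⇒trace {r = r} isGT (pl-out-sub {p} {q} {ℓ = ℓ} e ℓ∈ ip) =
  let τ , t , pos = InPlay⇒trace (IsGT-/ isGT e ℓ∈) ip
  in snd p q ℓ ∷ τ , tr-out e ℓ∈ t , ord-∷-pos (snd p q ℓ) τ r pos
InPlay⇒trace isGT (pl-in {p} {q} {ℓ} e played) =
  _ , tr-in e tr-nil , ord-∷-played (rcv p q ℓ) [] (sym played)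
InPlay⇒trace {r = r} isGT (pl-in-sub {p} {q} {ℓ} e ip) =
  let τ , t , pos = InPlay⇒trace (IsGT-/ isGT e (here refl)) ip
  in rcv p q ℓ ∷ τ , tr-in e t , ord-∷-pos (rcv p q ℓ) τ r pos

Depth≤-zero⇒¬InPlay : ∀ {X r} → IsGT X → Depth≤ r X 0 → ¬ InPlay r X
Depth≤-zero⇒¬InPlay isGT depth ip =
  let τ , t , pos = InPlay⇒trace isGT ip in n≮0 (≤-trans pos (depth τ t))

ProjRel : Set₁
ProjRel = GT → Part → Proc → Set

PostFixpoint : Set₁
PostFixpoint = Σ ProjRel λ R → ∀ G r P → R G r P → ProjF R G r P

Proj⇒PostFixpoint : ∀ {X r Y} → Proj X r Y → PostFixpoint
Proj⇒PostFixpoint (R , closed , _) = R , closed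

⋃ : {I : Set} → (I → PostFixpoint) → ProjRel
⋃ {I} F G r P = Σ I λ i → proj₁ (F i) G r P

HasPrefix-map : ∀ {K K' : Proc → Set} π {P} → (∀ {P'} → K P' → K' P') → HasPrefix π K P → HasPrefix π K' P
HasPrefix-map [] f k = f k
HasPrefix-map (a ∷ π) f (head≡ , rest) = head≡ , HasPrefix-map π f rest

residual : List Act → Proc → Proc
residual [] P = P
residual (a ∷ π) P = residual π (P /ₚ actLabel a)

HasPrefix-residual : ∀ {K : Proc → Set} π {P} → HasPrefix π K P → K (residual π P)
HasPrefix-residual [] k = k
HasPrefix-residual (a ∷ π) (_ , rest) = HasPrefix-residual π rest

HasPrefix-replace : ∀ {K K' : Proc → Set} π {P} → HasPrefix π K P → K' (residual π P) → HasPrefix π K' P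
HasPrefix-replace [] _ k' = k'
HasPrefix-replace (a ∷ π) (head≡ , rest) k' = head≡ , HasPrefix-replace π rest k'

HasPrefix-nonEnd : ∀ {K : Proc → Set} π {P} → (∀ {P'} → K P' → P' [] ≢ end) → HasPrefix π K P → P [] ≢ end
HasPrefix-nonEnd [] nonEnd k = nonEnd k
HasPrefix-nonEnd (aout _ _ ∷ π) _ (head≡ , _) P≡end with trans (sym head≡) P≡end
... | ()
HasPrefix-nonEnd (ain _ _ ∷ π) _ (head≡ , _) P≡end with trans (sym head≡) P≡end
... | ()

prefix-nonEnd : ∀ π a P → prefix π (step a P) [] ≢ end
prefix-nonEnd [] (aout _ _) _ ()
prefix-nonEnd [] (ain _ _) _ ()
prefix-nonEnd (aout _ _ ∷ _) _ _ ()
prefix-nonEnd (ain _ _ ∷ _) _ _ ()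

ProjF-mono : ∀ {R S : ProjRel} → (∀ {G r P} → R G r P → S G r P) → ∀ {G r P} → ProjF R G r P → ProjF S G r P
ProjF-mono f (pj-zero ¬ip P≡end) = pj-zero ¬ip P≡end
ProjF-mono f (pj-send e r≡p P≡ perm hs) = pj-send e r≡p P≡ perm λ ℓ ℓ∈ → f (hs ℓ ℓ∈)
ProjF-mono f (pj-recv1 e r≡q r≢p ip h) = pj-recv1 e r≡q r≢p ip (f h)
ProjF-mono f (pj-recvN e r≡q r≢p ip 1<ls π hp) =
  pj-recvN e r≡q r≢p ip 1<ls π
    (HasPrefix-map π (λ (ls' , P≡ , perm , hs) → ls' , P≡ , perm , λ ℓ ℓ∈ → f (hs ℓ ℓ∈)) hp)
ProjF-mono f (pj-other e r≢p r≢q ip hs) = pj-other e r≢p r≢q ip λ ℓ ℓ∈ → f (hs ℓ ℓ∈)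
ProjF-mono f (pj-in-rcv e r≡q P≡ h) = pj-in-rcv e r≡q P≡ (f h)
ProjF-mono f (pj-in-other e r≢q ip h) = pj-in-other e r≢q ip (f h)

Proj-intro : ∀ {I : Set} (F : I → PostFixpoint) {X r Y} → ProjF (⋃ F) X r Y → Proj X r Y
Proj-intro {I} F {X} {r} {Y} unfolded = R , closed , inj₁ (refl , refl , refl)
  where
  R : ProjRel
  R G r' P = ((G ≡ X) × (r' ≡ r) × (P ≡ Y)) ⊎ ⋃ F G r' P
  closed : ∀ G r' P → R G r' P → ProjF R G r' P
  closed _ _ _ (inj₁ (refl , refl , refl)) = ProjF-mono inj₂ unfolded
  closed G r' P (inj₂ (i , h)) = ProjF-mono (λ h' → inj₂ (i , h')) (proj₂ (F i) G r' P h)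

Proj-nonEnd⇒InPlay : ∀ {X r Y} → Proj X r Y → Y [] ≢ end → InPlay r X
Proj-nonEnd⇒InPlay {X} {r} {Y} (R , closed , h) Y≢end with closed X r Y h
... | pj-zero _ Y≡end = ⊥-elim (Y≢end Y≡end)
... | pj-send e refl _ _ _ = pl-out e refl
... | pj-recv1 _ _ _ ip _ = ip
... | pj-recvN _ _ _ ip _ _ _ = ip
... | pj-other e _ _ ip _ = pl-out-sub e (here refl) ip
... | pj-in-rcv e refl _ _ = pl-in e refl
... | pj-in-other e _ ip _ = pl-in-sub e ip

Plays : Part → GNode → Set
Plays r (gout a _ _) = r ≡ a
Plays r (gin _ b _) = r ≡ b
Plays r gend = ⊥

ProjF-end⁻¹ : ∀ {R X r Y} → ProjF R X r Y → Y [] ≡ end →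
              ¬ InPlay r X ⊎ (¬ Plays r (X []) × (∀ ℓ → ℓ ∈ gchildren (X []) → R (X / ℓ) r Y))
ProjF-end⁻¹ (pj-zero ¬ip _) _ = inj₁ ¬ip
ProjF-end⁻¹ (pj-send _ _ Y≡ _ _) Y≡end = ⊥-elim (≡out⇒≢end Y≡ Y≡end)
ProjF-end⁻¹ (pj-recv1 e refl r≢p _ h) _ rewrite e = inj₂ (r≢p , λ { _ (here refl) → h })
ProjF-end⁻¹ (pj-recvN _ _ _ _ _ π hp) Y≡end =
  ⊥-elim (HasPrefix-nonEnd π (λ (_ , Y≡ , _) → ≡inp⇒≢end Y≡) hp Y≡end)
ProjF-end⁻¹ (pj-other e r≢p _ _ hs) _ rewrite e = inj₂ (r≢p , hs)
ProjF-end⁻¹ (pj-in-rcv _ _ Y≡ _) Y≡end = ⊥-elim (≡inp⇒≢end Y≡ Y≡end)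
ProjF-end⁻¹ (pj-in-other e r≢q _ h) _ rewrite e = inj₂ (r≢q , λ { _ (here refl) → h })

Proj-end⇒¬InPlay : ∀ {X r Y} → Proj X r Y → Y [] ≡ end → ¬ InPlay r X
Proj-end⇒¬InPlay {r = r} {Y} (R , closed , h) Y≡end ip = absent ip h
  where
  absent : ∀ {X} → InPlay r X → ¬ R X r Y
  absent {X} ip h with ProjF-end⁻¹ (closed X r Y h) Y≡end
  ... | inj₁ ¬ip = ¬ip ip
  absent (pl-out e r≡p) h | inj₂ (¬plays , _) = ¬plays (subst (Plays r) (sym e) r≡p)
  absent (pl-out-sub e ℓ∈ ip) h | inj₂ (_ , hs) = absent ip (hs _ (∈-gchildren e ℓ∈))
  absent (pl-in e r≡q) h | inj₂ (¬plays , _) = ¬plays (subst (Plays r) (sym e) r≡q)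
  absent (pl-in-sub e ip) h | inj₂ (_ , hs) = absent ip (hs _ (∈-gchildren e (here refl)))

record Transition (G : GT) (M : Queue) (β : Comm) (M' : Queue) (Y : Proc) : Set₁ where
  field
    target   : GT
    reaches  : Step G M β target M'
    projects : Proj target (playC β) Y

Transition-resp-≈Q : ∀ {G M β M₁ M₂ Y} → Transition G M β M₁ Y → M₁ ≈Q M₂ → Transition G M β M₂ Y
Transition-resp-≈Q t M₁≈M₂ = record
  { target = Transition.target t
  ; reaches = Step-resp-≈Q (Transition.reaches t) M₁≈M₂
  ; projects = Transition.projects t
  }

branchChild : (ls : List Label) → (∀ ℓ → ℓ ∈ ls → GT) → ∀ ℓ → Dec (ℓ ∈ ls) → GT
branchChild ls f ℓ (yes ℓ∈) = f ℓ ℓ∈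
branchChild ls f ℓ (no _) _ = gend  -- not a valid path of the branching

branch : Part → Part → (ls : List Label) → (∀ ℓ → ℓ ∈ ls → GT) → GT
branch a b ls f [] = gout a b ls
branch a b ls f (ℓ ∷ π) = branchChild ls f ℓ (ℓ ∈? ls) π

branch-/ : ∀ {a b ls f} (Q : Label → GT → Set) → (∀ ℓ ℓ∈ → Q ℓ (f ℓ ℓ∈)) →
           ∀ ℓ → ℓ ∈ ls → Q ℓ (branch a b ls f / ℓ)
branch-/ {ls = ls} {f} Q q ℓ ℓ∈ = chosen (ℓ ∈? ls)
  where
  chosen : (d : Dec (ℓ ∈ ls)) → Q ℓ (branchChild ls f ℓ d)
  chosen (yes ℓ∈') = q ℓ ℓ∈'
  chosen (no ℓ∉) = ⊥-elim (ℓ∉ ℓ∈)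

module UnderOutput {X M M' β a b ls} {Yf : Label → Proc}
  (e : X [] ≡ gout a b ls) (β≢a : playC β ≢ a)
  (children : ∀ ℓ → ℓ ∈ ls → Transition (X / ℓ) (M ∷ʳ msg a ℓ b) β (M' ∷ʳ msg a ℓ b) (Yf ℓ)) where

  private
    childProj : ∀ ℓ (ℓ∈ : ℓ ∈ ls) → Proj (Transition.target (children ℓ ℓ∈)) (playC β) (Yf ℓ)
    childProj ℓ ℓ∈ = Transition.projects (children ℓ ℓ∈)

    childFixpoint : Σ Label (_∈ ls) → PostFixpoint
    childFixpoint (ℓ , ℓ∈) = Proj⇒PostFixpoint (childProj ℓ ℓ∈)

  target : GT
  target = branch a b ls λ ℓ ℓ∈ → Transition.target (children ℓ ℓ∈)

  target-/ : (Q : Label → GT → Set) → (∀ ℓ ℓ∈ → Q ℓ (Transition.target (children ℓ ℓ∈))) →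
             ∀ ℓ → ℓ ∈ ls → Q ℓ (target / ℓ)
  target-/ = branch-/ {a} {b} {ls}

  Children : ProjRel
  Children = ⋃ childFixpoint

  children-related : ∀ ℓ → ℓ ∈ ls → Children (target / ℓ) (playC β) (Yf ℓ)
  children-related = target-/ (λ ℓ G → Children G (playC β) (Yf ℓ))
    λ ℓ ℓ∈ → (ℓ , ℓ∈) , proj₂ (proj₂ (childProj ℓ ℓ∈))

  child-inPlay : ∀ ℓ → ℓ ∈ ls → Yf ℓ [] ≢ end → InPlay (playC β) (target / ℓ)
  child-inPlay = target-/ (λ ℓ G → Yf ℓ [] ≢ end → InPlay (playC β) G)
    λ ℓ ℓ∈ → Proj-nonEnd⇒InPlay (childProj ℓ ℓ∈)

  ¬inPlay : (∀ ℓ → ℓ ∈ ls → Yf ℓ [] ≡ end) → ¬ InPlay (playC β) target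
  ¬inPlay ends ip with InPlay-out⁻¹ refl β≢a ip
  ... | ℓ , ℓ∈ , ip' = target-/ (λ ℓ G → ¬ InPlay (playC β) G)
    (λ ℓ ℓ∈ → Proj-end⇒¬InPlay (childProj ℓ ℓ∈) (ends ℓ ℓ∈)) ℓ ℓ∈ ip'

  transition : ∀ {Y} → (Y [] ≡ end → ∀ ℓ → ℓ ∈ ls → Yf ℓ [] ≡ end) →
               (Y [] ≢ end → ProjF Children target (playC β) Y) → Transition X M β M' Y
  transition {Y} ends unfold = record
    { target = target
    ; reaches = icomm-out e refl (≢-sym β≢a)
        (target-/ (λ ℓ G → Step (X / ℓ) (M ∷ʳ msg a ℓ b) β G (M' ∷ʳ msg a ℓ b))
          λ ℓ ℓ∈ → Transition.reaches (children ℓ ℓ∈))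
    ; projects = Proj-intro childFixpoint unfolded
    }
    where
    unfolded : ProjF Children target (playC β) Y
    unfolded with end? (Y [])
    ... | yes Y≡end = pj-zero (¬inPlay (ends Y≡end)) Y≡end
    ... | no Y≢end = unfold Y≢end

transition-recv1 : ∀ {X M M' β a ℓ Y} → X [] ≡ gout a (playC β) (ℓ ∷ []) → playC β ≢ a →
                   Transition (X / ℓ) (M ∷ʳ msg a ℓ (playC β)) β (M' ∷ʳ msg a ℓ (playC β)) Y →
                   Transition X M β M' Y
transition-recv1 {X} {M} {M'} {β} {a} {ℓ} {Y} e β≢a t = transition (λ Y≡end _ _ → Y≡end) λ Y≢end →
  pj-recv1 refl refl β≢a (pl-out-sub refl (here refl) (child-inPlay _ (here refl) Y≢end))
    (children-related _ (here refl))
  where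
  theChild : ∀ ℓ' → ℓ' ∈ ℓ ∷ [] →
             Transition (X / ℓ') (M ∷ʳ msg a ℓ' (playC β)) β (M' ∷ʳ msg a ℓ' (playC β)) Y
  theChild _ (here refl) = t
  open UnderOutput {X} {Yf = λ _ → Y} e β≢a theChild

transition-other : ∀ {X M M' β a b ℓ₁ ls Y} → X [] ≡ gout a b (ℓ₁ ∷ ls) → playC β ≢ a → playC β ≢ b →
                   (∀ ℓ → ℓ ∈ ℓ₁ ∷ ls → Transition (X / ℓ) (M ∷ʳ msg a ℓ b) β (M' ∷ʳ msg a ℓ b) Y) →
                   Transition X M β M' Y
transition-other {X} {Y = Y} e β≢a β≢b ts = transition (λ Y≡end _ _ → Y≡end) λ Y≢end →
  pj-other refl β≢a β≢b (child-inPlay _ (here refl) Y≢end) children-related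
  where
  open UnderOutput {X} {Yf = λ _ → Y} e β≢a ts

InputHead : Part → List Label → Proc → Set
InputHead a ls P = Σ (List Label) λ ls' → (P [] ≡ inp a ls') × (ls ↭ ls')

transition-recvN : ∀ {X M M' β a ls Y} → X [] ≡ gout a (playC β) ls → playC β ≢ a → 1 < length ls →
                   (π : List Act) → HasPrefix π (InputHead a ls) Y →
                   (∀ ℓ → ℓ ∈ ls → Transition (X / ℓ) (M ∷ʳ msg a ℓ (playC β)) β (M' ∷ʳ msg a ℓ (playC β))
                                     (prefix π (step (ain a ℓ) (residual π Y /ₚ ℓ)))) →
                   Transition X M β M' Y
transition-recvN {X} {a = a} {ℓ₁ ∷ _} e β≢a 1<ls π hp ts =
  let ls' , Y≡ , perm = HasPrefix-residual π hp in
  transition (λ Y≡end → ⊥-elim (HasPrefix-nonEnd π (λ (_ , P≡ , _) → ≡inp⇒≢end P≡) hp Y≡end))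
    λ _ → pj-recvN refl refl β≢a
            (pl-out-sub refl (here refl) (child-inPlay ℓ₁ (here refl) (prefix-nonEnd π (ain a ℓ₁) _)))
            1<ls π (HasPrefix-replace π hp (ls' , Y≡ , perm , children-related))
  where
  open UnderOutput {X} e β≢a ts

transition-in : ∀ {X M M' M₀ M₀' β a b ℓ Y} → X [] ≡ gin a b ℓ → playC β ≢ b →
                M ≈Q (msg a ℓ b ∷ M₀) → M' ≈Q (msg a ℓ b ∷ M₀') →
                Transition (X / ℓ) M₀ β M₀' Y → Transition X M β M' Y
transition-in {β = β} {a} {b} {ℓ} {Y} e β≢b M≈ M'≈ t = record
  { target = target
  ; reaches = icomm-in e refl M≈ M'≈ (≢-sym β≢b) (Transition.reaches t)
  ; projects = Proj-intro childFixpoint unfolded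
  }
  where
  target : GT
  target [] = gin a b ℓ
  target (_ ∷ π) = Transition.target t π
  childFixpoint : ⊤ → PostFixpoint
  childFixpoint _ = Proj⇒PostFixpoint (Transition.projects t)
  unfolded : ProjF (⋃ childFixpoint) target (playC β) Y
  unfolded with end? (Y [])
  ... | yes Y≡end =
    pj-zero (λ ip → Proj-end⇒¬InPlay (Transition.projects t) Y≡end (InPlay-in⁻¹ refl β≢b ip)) Y≡end
  ... | no Y≢end = pj-in-other refl β≢b (Proj-nonEnd⇒InPlay (Transition.projects t) Y≢end)
                     (tt , proj₂ (proj₂ (Transition.projects t)))

Balanced-out : ∀ {X M a b ls ℓ} → Balanced X M → X [] ≡ gout a b ls → ℓ ∈ ls →
               Balanced (X / ℓ) (M ∷ʳ msg a ℓ b)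
Balanced-out {X} {M} (R , closed , h) e ℓ∈ with closed X M h
... | bal-end e' _ with trans (sym e) e'
...   | ()
Balanced-out (R , closed , h) e ℓ∈ | bal-in e' _ _ = ⊥-elim (gout≢gin (trans (sym e) e'))
Balanced-out (R , closed , h) e ℓ∈ | bal-out e' _ hs with trans (sym e) e'
... | refl = R , closed , hs _ ℓ∈

Balanced-in : ∀ {X M a b ℓ} → Balanced X M → X [] ≡ gin a b ℓ →
              Σ Queue λ M₀ → (M ≈Q (msg a ℓ b ∷ M₀)) × Balanced (X / ℓ) M₀
Balanced-in {X} {M} (R , closed , h) e with closed X M h
... | bal-end e' _ with trans (sym e) e'
...   | ()
Balanced-in (R , closed , h) e | bal-out e' _ _ = ⊥-elim (gout≢gin (trans (sym e') e))
Balanced-in (R , closed , h) e | bal-in e' M≈ h' with trans (sym e) e'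
... | refl = _ , M≈ , R , closed , h'

record Admissible (N : ℕ) (r : Part) (X : GT) (M : Queue) : Set₁ where
  field
    isGT     : IsGT X
    depth≤   : Depth≤ r X N
    balanced : Balanced X M

Admissible-start : ∀ {G M r P} → IsGT G → Bounded G → Balanced G M → Proj G r P → P [] ≢ end →
                   Σ ℕ λ N → Admissible N r G M
Admissible-start isGT bounded balanced prj P≢end =
  let N , depth≤ = bounded [] v-root _ (Proj-nonEnd⇒InPlay prj P≢end)
  in N , record { isGT = isGT ; depth≤ = depth≤ ; balanced = balanced }

Admissible-zero : ∀ {r X M} → Admissible 0 r X M → ¬ InPlay r X
Admissible-zero adm = Depth≤-zero⇒¬InPlay (Admissible.isGT adm) (Admissible.depth≤ adm)

Admissible-out : ∀ {N r X M a b ls ℓ} → Admissible (suc N) r X M → X [] ≡ gout a b ls → r ≢ a → ℓ ∈ ls →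
                 Admissible N r (X / ℓ) (M ∷ʳ msg a ℓ b)
Admissible-out adm e r≢a ℓ∈ = record
  { isGT = IsGT-/ (Admissible.isGT adm) e ℓ∈
  ; depth≤ = Depth≤-out e ℓ∈ r≢a (Admissible.depth≤ adm)
  ; balanced = Balanced-out (Admissible.balanced adm) e ℓ∈
  }

Admissible-in : ∀ {N r X M a b ℓ} → Admissible (suc N) r X M → X [] ≡ gin a b ℓ → r ≢ b →
                Σ Queue λ M₀ → (M ≈Q (msg a ℓ b ∷ M₀)) × Admissible N r (X / ℓ) M₀
Admissible-in adm e r≢b =
  let M₀ , M≈ , balanced = Balanced-in (Admissible.balanced adm) e
  in M₀ , M≈ , record
    { isGT = IsGT-/ (Admissible.isGT adm) e (here refl)
    ; depth≤ = Depth≤-in e r≢b (Admissible.depth≤ adm)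
    ; balanced = balanced
    }

RecvNBranches : ProjRel → GT → Part → Part → List Label → List Act → Proc → Set
RecvNBranches R X a r ls π P =
  Σ (List Label) λ ls' → (P [] ≡ inp a ls') × (ls ↭ ls')
    × (∀ ℓ → ℓ ∈ ls → R (X / ℓ) r (prefix π (step (ain a ℓ) (P /ₚ ℓ))))

SendLemma : ℕ → Set₁
SendLemma N = ∀ {X M p q P ls ℓ} → Admissible N p X M → Proj X p P → P [] ≡ out q ls → ℓ ∈ ls →
              Transition X M (snd p q ℓ) (M ∷ʳ msg p ℓ q) (P /ₚ ℓ)

send-under-output : ∀ {N X M p q P ls ℓ a b ls₀ ℓ₀} → SendLemma N → Admissible (suc N) p X M →
                    X [] ≡ gout a b ls₀ → p ≢ a → ℓ₀ ∈ ls₀ → Proj (X / ℓ₀) p P → P [] ≡ out q ls → ℓ ∈ ls →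
                    Transition (X / ℓ₀) (M ∷ʳ msg a ℓ₀ b) (snd p q ℓ) ((M ∷ʳ msg p ℓ q) ∷ʳ msg a ℓ₀ b)
                               (P /ₚ ℓ)
send-under-output {M = M} send adm e p≢a ℓ₀∈ prj P≡ ℓ∈ =
  Transition-resp-≈Q (send (Admissible-out adm e p≢a ℓ₀∈) prj P≡ ℓ∈) (≈Q-swapLast M (inj₁ (≢-sym p≢a)))

send-recvN : ∀ {N R X M p q P ls ℓ a ls₀} → SendLemma N → Admissible (suc N) p X M →
             X [] ≡ gout a p ls₀ → p ≢ a → 1 < length ls₀ → (∀ G r P → R G r P → ProjF R G r P) →
             (π : List Act) → HasPrefix π (RecvNBranches R X a p ls₀ π) P → P [] ≡ out q ls → ℓ ∈ ls →
             Transition X M (snd p q ℓ) (M ∷ʳ msg p ℓ q) (P /ₚ ℓ)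
send-recvN send adm e p≢a 1<ls closed [] (_ , P≡' , _) P≡ _ = ⊥-elim (out≢inp (trans (sym P≡) P≡'))
send-recvN send adm e p≢a 1<ls closed (ain _ _ ∷ _) (P≡' , _) P≡ _ = ⊥-elim (out≢inp (trans (sym P≡) P≡'))
send-recvN send adm e p≢a 1<ls closed (aout _ _ ∷ π) (P≡' , hp) P≡ ℓ∈ with trans (sym P≡') P≡ | ℓ∈
... | refl | here refl =
  let ls' , P'≡ , perm , branches = HasPrefix-residual π hp
  in transition-recvN e p≢a 1<ls π (HasPrefix-replace π hp (ls' , P'≡ , perm)) λ ℓ₀ ℓ₀∈ →
       send-under-output send adm e p≢a ℓ₀∈ (_ , closed , branches ℓ₀ ℓ₀∈) refl (here refl)

send-step : ∀ {N} → SendLemma N → SendLemma (suc N)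
send-step send {X} {p = p} {P = P} {ℓ = ℓ} adm (R , closed , h) P≡ ℓ∈ with closed X p P h
... | pj-zero _ P≡end = ⊥-elim (≡out⇒≢end P≡ P≡end)
... | pj-in-rcv _ _ P≡' _ = ⊥-elim (out≢inp (trans (sym P≡) P≡'))
... | pj-send e refl P≡' perm hs with trans (sym P≡') P≡
...   | refl = record
  { target = X / ℓ
  ; reaches = ext-out e (∈-resp-↭ (↭-sym perm) ℓ∈) (≅G-refl _) ≈refl
  ; projects = R , closed , hs ℓ (∈-resp-↭ (↭-sym perm) ℓ∈)
  }
send-step send adm (R , closed , h) P≡ ℓ∈ | pj-recv1 e refl p≢a _ h' =
  transition-recv1 e p≢a (send-under-output send adm e p≢a (here refl) (R , closed , h') P≡ ℓ∈)
send-step send adm (R , closed , h) P≡ ℓ∈ | pj-other e p≢a p≢b _ hs =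
  transition-other e p≢a p≢b λ ℓ₀ ℓ₀∈ → send-under-output send adm e p≢a ℓ₀∈ (R , closed , hs ℓ₀ ℓ₀∈) P≡ ℓ∈
send-step send adm (R , closed , h) P≡ ℓ∈ | pj-in-other e p≢b _ h' =
  let M₀ , M≈ , adm' = Admissible-in adm e p≢b
  in transition-in e p≢b M≈ (≈Q-∷ʳ _ M≈) (send adm' (R , closed , h') P≡ ℓ∈)
send-step send adm (R , closed , h) P≡ ℓ∈ | pj-recvN e refl p≢a _ 1<ls π hp =
  send-recvN send adm e p≢a 1<ls closed π hp P≡ ℓ∈

send-transition : ∀ N → SendLemma N
send-transition zero adm prj P≡ _ =
  ⊥-elim (Admissible-zero adm (Proj-nonEnd⇒InPlay prj (≡out⇒≢end P≡)))
send-transition (suc N) = send-step (send-transition N)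

ReceiveLemma : ℕ → Set₁
ReceiveLemma N = ∀ {X M M' p q P ls ℓ} → Admissible N q X M → Proj X q P → P [] ≡ inp p ls →
                 M ≈Q (msg p ℓ q ∷ M') → (ls ≡ ℓ ∷ []) × Transition X M (rcv p q ℓ) M' (P /ₚ ℓ)

receive-under-output : ∀ {N X M M' p q P ls ℓ a b ls₀ ℓ₀} → ReceiveLemma N → Admissible (suc N) q X M →
                       X [] ≡ gout a b ls₀ → q ≢ a → ℓ₀ ∈ ls₀ → Proj (X / ℓ₀) q P → P [] ≡ inp p ls →
                       M ≈Q (msg p ℓ q ∷ M') →
                       (ls ≡ ℓ ∷ []) ×
                       Transition (X / ℓ₀) (M ∷ʳ msg a ℓ₀ b) (rcv p q ℓ) (M' ∷ʳ msg a ℓ₀ b) (P /ₚ ℓ)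
receive-under-output receive adm e q≢a ℓ₀∈ prj P≡ M≈ =
  receive (Admissible-out adm e q≢a ℓ₀∈) prj P≡ (≈Q-∷ʳ _ M≈)

receive-recvN : ∀ {N R X M M' p q P ls ℓ a ls₀} → ReceiveLemma N → Admissible (suc N) q X M →
                X [] ≡ gout a q ls₀ → q ≢ a → 1 < length ls₀ → (∀ G r P → R G r P → ProjF R G r P) →
                (π : List Act) → HasPrefix π (RecvNBranches R X a q ls₀ π) P → P [] ≡ inp p ls →
                M ≈Q (msg p ℓ q ∷ M') → (ls ≡ ℓ ∷ []) × Transition X M (rcv p q ℓ) M' (P /ₚ ℓ)
-- Every branch would have to consume the queued message first, but the branch labels are distinct.
receive-recvN receive adm e q≢a 1<ls closed [] (_ , P≡' , _ , branches) P≡ M≈ with trans (sym P≡') P≡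
... | refl = ⊥-elim (Unique⇒¬allEqual (proj₂ (IsGT-outLabels (Admissible.isGT adm) e)) 1<ls λ ℓ₀ ℓ₀∈ →
               ∷-injectiveˡ (proj₁ (receive-under-output receive adm e q≢a ℓ₀∈
                                      (_ , closed , branches ℓ₀ ℓ₀∈) refl M≈)))
receive-recvN receive adm e q≢a 1<ls closed (aout _ _ ∷ _) (P≡' , _) P≡ M≈ =
  ⊥-elim (out≢inp (trans (sym P≡') P≡))
receive-recvN {X = X} {M} {M'} {p} {q} {P} {ℓ = ℓ} {ls₀ = ℓ₁ ∷ _}
              receive adm e q≢a 1<ls closed (ain _ _ ∷ π) (P≡' , hp) P≡ M≈ with trans (sym P≡') P≡
... | refl =
  let ls' , P'≡ , perm , branches = HasPrefix-residual π hp
      child = λ ℓ₀ ℓ₀∈ → receive-under-output receive adm e q≢a ℓ₀∈ (_ , closed , branches ℓ₀ ℓ₀∈) refl M≈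
      ls≡ = proj₁ (child ℓ₁ (here refl))
  in ls≡ , subst (λ ℓ'' → Transition X M (rcv p q ℓ) M' (P /ₚ ℓ'')) (∷-injectiveˡ ls≡)
             (transition-recvN e q≢a 1<ls π (HasPrefix-replace π hp (ls' , P'≡ , perm)) λ ℓ₀ ℓ₀∈ →
                proj₂ (child ℓ₀ ℓ₀∈))

receive-step : ∀ {N} → ReceiveLemma N → ReceiveLemma (suc N)
receive-step receive {X} {q = q} {P = P} {ℓ = ℓ} adm (R , closed , h) P≡ M≈ with closed X q P h
... | pj-zero _ P≡end = ⊥-elim (≡inp⇒≢end P≡ P≡end)
... | pj-send _ _ P≡' _ _ = ⊥-elim (out≢inp (trans (sym P≡') P≡))
... | pj-in-rcv e refl P≡' h' with trans (sym P≡') P≡ | Balanced-in (Admissible.balanced adm) e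
...   | refl | M₀ , M≈₀ , _ with ≈Q-∷-sameChannel⁻¹ (≈trans (≈sym M≈₀) M≈)
...     | refl , M₀≈M' = refl , record
  { target = X / ℓ
  ; reaches = ext-in e M≈₀ (≅G-refl _) (≈sym M₀≈M')
  ; projects = R , closed , h'
  }
receive-step receive adm (R , closed , h) P≡ M≈ | pj-in-other e q≢b _ h' =
  let M₀ , M≈₀ , adm' = Admissible-in adm e q≢b
      _ , M₀≈ , M'≈ = ≈Q-∷-otherChannel⁻¹ (λ (_ , b≡q) → q≢b (sym b≡q)) (≈trans (≈sym M≈₀) M≈)
  in map₂ (transition-in e q≢b M≈₀ M'≈) (receive adm' (R , closed , h') P≡ M₀≈)
receive-step receive adm (R , closed , h) P≡ M≈ | pj-recv1 e refl q≢a _ h' =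
  map₂ (transition-recv1 e q≢a) (receive-under-output receive adm e q≢a (here refl) (R , closed , h') P≡ M≈)
receive-step receive adm (R , closed , h) P≡ M≈ | pj-other e q≢a q≢b _ hs =
  let child = λ ℓ₀ ℓ₀∈ → receive-under-output receive adm e q≢a ℓ₀∈ (R , closed , hs ℓ₀ ℓ₀∈) P≡ M≈
  in proj₁ (child _ (here refl)) , transition-other e q≢a q≢b λ ℓ₀ ℓ₀∈ → proj₂ (child ℓ₀ ℓ₀∈)
receive-step receive adm (R , closed , h) P≡ M≈ | pj-recvN e refl q≢a _ 1<ls π hp =
  receive-recvN receive adm e q≢a 1<ls closed π hp P≡ M≈

receive-transition : ∀ N → ReceiveLemma N
receive-transition zero adm prj P≡ _ =
  ⊥-elim (Admissible-zero adm (Proj-nonEnd⇒InPlay prj (≡inp⇒≢end P≡)))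
receive-transition (suc N) = receive-step (receive-transition N)

lemma3p10 : (G : GT) (M : Queue) → IsGT G → Regular G → WellFormed G M →
    ((p q : Part) (P : Proc) (ls : List Label) → Proj G p P → P [] ≡ out q ls →
      (ℓ : Label) → ℓ ∈ ls →
      Σ GT λ Gℓ → Step G M (snd p q ℓ) Gℓ (M ∷ʳ msg p ℓ q) × Proj Gℓ p (P /ₚ ℓ))
    ×
    ((p q : Part) (P : Proc) (ls : List Label) (ℓ : Label) (M' : Queue) →
      Proj G q P → P [] ≡ inp p ls → M ≈Q (msg p ℓ q ∷ M') →
      (ls ≡ ℓ ∷ []) ×
      Σ GT λ G' → Step G M (rcv p q ℓ) G' M' × Proj G' q (P /ₚ ℓ))
lemma3p10 G M isGT _ (balanced , _ , bounded) =
  (λ p q P ls prj P≡ ℓ ℓ∈ →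
    let N , adm = start prj (≡out⇒≢end P≡)
    in reached (send-transition N adm prj P≡ ℓ∈)) ,
  (λ p q P ls ℓ M' prj P≡ M≈ →
    let N , adm = start prj (≡inp⇒≢end P≡)
    in map₂ reached (receive-transition N adm prj P≡ M≈))
  where
  start : ∀ {r P} → Proj G r P → P [] ≢ end → Σ ℕ λ N → Admissible N r G M
  start = Admissible-start isGT bounded balanced

  reached : ∀ {β M' Y} → Transition G M β M' Y → Σ GT λ G' → Step G M β G' M' × Proj G' (playC β) Y
  reached t = Transition.target t , Transition.reaches t , Transition.projects t
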